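{- Let $s,m$ be positive integers and let $\lambda$ be a partition with distinct parts, with set $H$ of first-column hook lengths. \begin{enumerate} \item If $\lambda$ is an $(s,s+1)$-core, then $H\subseteq\{1,2,\dots,s-1\}$. \item If $ms\geq 2$ and $\lambda$ is an $(s,ms-1)$-core, then $H\subseteq\{\,i+\ell s: 0\leq\ell\leq m-2,\ 1\leq i\leq s-1\,\}\cup\{\,i+(m-1)s : 1\leq i\leq s-2\,\}$. \item If $\lambda$ is an $(s,ms+1)$-core, then $H\subseteq\{\,i+\ell s: 0\leq\ell\leq m-1,\ 1\leq i\leq s-1\,\}$. \end{enumerate} (Equivalently: the minimal abacus of $\lambda$ uses only beads from the first row (row $j=0$) of the minimal abacus of the corresponding maximal core.)
   Context: For a box of the Young diagram of a partition, its hook length is the number of boxes in the same row weakly to its right plus the number in the same column strictly below. An $(a,b)$-core is a partition having no hook length equal to $a$ or to $b$. The first-column hook lengths are the hook lengths of boxes in the first column. -}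

module Defs where

open import Data.Nat using (ℕ; zero; suc; _+_; _*_; _∸_; _≤_; _<_; _>_; _≥_)
open import Data.Nat.Properties using (_<?_)
open import Data.List using (List; []; _∷_; length; lookup; filter; drop)
open import Data.List.Relation.Unary.All using (All)
open import Data.List.Relation.Unary.Linked using (Linked)
open import Data.Fin using (Fin; toℕ)
open import Data.Product using (Σ; ∃; _×_; _,_)
open import Relation.Nullary using (¬_)
open import Relation.Binary.PropositionalEquality using (_≡_)

record Partition : Set where
  constructor mkPartition
  field
    parts    : List ℕ
    positive : All (λ x → 0 < x) parts
    weakDec  : Linked _≥_ parts
open Partition public

DistinctParts : Partition → Set
DistinctParts λ′ = Linked _>_ (parts λ′)

rows : Partition → ℕ
rows λ′ = length (parts λ′)

part : (λ′ : Partition) → Fin (rows λ′) → ℕ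
part λ′ r = lookup (parts λ′) r

legLength : (λ′ : Partition) → Fin (rows λ′) → ℕ → ℕ
legLength λ′ r c = length (filter (λ x → c <? x) (drop (suc (toℕ r)) (parts λ′)))

-- hook length of box (r , c) (0-indexed; box exists when c < part r):
-- boxes weakly to the right in the same row, plus boxes strictly below in the same column
hook : (λ′ : Partition) → Fin (rows λ′) → ℕ → ℕ
hook λ′ r c = (part λ′ r ∸ c) + legLength λ′ r c

HasHook : Partition → ℕ → Set
HasHook λ′ h = Σ (Fin (rows λ′)) λ r → Σ ℕ λ c → (c < part λ′ r) × (hook λ′ r c ≡ h)

IsCore : ℕ → ℕ → Partition → Set
IsCore a b λ′ = ¬ HasHook λ′ a × ¬ HasHook λ′ b

FirstColumnHooksIn : Partition → (ℕ → Set) → Set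
FirstColumnHooksIn λ′ P = (r : Fin (rows λ′)) → P (hook λ′ r 0)

module Submission where

-- Let λ₀ > λ₁ > … > λ_{k-1} be the parts of a partition with distinct parts.
-- The first-column hook of row r is λ_r + (k - 1 - r); write H for the set
-- of these numbers (the beads of the abacus of the partition).
--
-- The hooks in the row with first-column hook h are the
--    numbers h - h′ with 0 ≤ h′ < h and h′ ∉ H (rowHooks).  So if no hook
--    equals a, then H is closed under subtracting a (noHook⇒descends), and
--    hence under subtracting every multiple of a (descends-multiple).
--  * Distinct parts.  First-column hooks are positive, and those of two rows
--    differ by at least 2 (firstHook-positive, firstHook-sparse).
--  * Sparse sets.  A set of positive integers without two consecutive
--    elements that is closed under subtracting a and a + 1 lies below a,
--    and if it is closed under subtracting s it contains no multiple of s
--    (module SparseSet).  Each part of the theorem then bounds h, excludes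
--    the multiples of s, and reads off the base-s digits of h.

open import Defs
open import Data.Nat using (ℕ; zero; suc; _+_; _*_; _∸_; _≤_; _<_; _>_; z≤n; s≤s; _<?_; _≤?_; NonZero)
open import Data.Nat.Properties
open import Data.Nat.DivMod using (_/_; _%_; m≡m%n+[m/n]*n; m%n<n)
open import Data.Nat.Tactic.RingSolver using (solve-∀)
open import Data.List using (List; []; _∷_; length; lookup; filter; drop)
open import Data.List.Properties using (filter-all; filter-none; filter-accept)
open import Data.List.Relation.Unary.All as All using (All; []; _∷_)
open import Data.List.Relation.Unary.All.Properties using (drop⁺)
open import Data.List.Relation.Unary.Linked using (Linked; [-]; _∷_) renaming (head to linked-head; tail to linked-tail)
open import Data.List.Relation.Unary.Linked.Properties using (Linked⇒All)
open import Data.Fin using (Fin; toℕ) renaming (zero to fzero; suc to fsuc)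
open import Data.Product using (Σ; _×_; _,_)
open import Data.Sum using (_⊎_; inj₁; inj₂)
open import Data.Empty using (⊥; ⊥-elim)
open import Relation.Nullary using (¬_; yes; no)
open import Relation.Binary.PropositionalEquality

data Suffix {A : Set} : List A → List A → Set where
  here  : ∀ {xs} → Suffix xs xs
  there : ∀ {y xs ys} → Suffix xs ys → Suffix xs (y ∷ ys)

suffix-trans : ∀ {A : Set} {xs ys zs : List A} → Suffix xs ys → Suffix ys zs → Suffix xs zs
suffix-trans s here      = s
suffix-trans s (there t) = there (suffix-trans s t)

suffix-linked : ∀ {A : Set} {R : A → A → Set} {xs ys} → Suffix xs ys → Linked R ys → Linked R xs
suffix-linked here      l = l
suffix-linked (there s) l = suffix-linked s (linked-tail l)

suffix-all : ∀ {A : Set} {P : A → Set} {xs ys} → Suffix xs ys → All P ys → All P xs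
suffix-all here      a       = a
suffix-all (there s) (_ ∷ a) = suffix-all s a

lookup-suffix : ∀ {A : Set} (xs : List A) (r : Fin (length xs)) →
  Suffix (lookup xs r ∷ drop (suc (toℕ r)) xs) xs
lookup-suffix (x ∷ xs) fzero    = here
lookup-suffix (x ∷ xs) (fsuc r) = there (lookup-suffix xs r)

suffix-lookup : ∀ {A : Set} {y : A} {ys xs} → Suffix (y ∷ ys) xs →
  Σ (Fin (length xs)) λ r → lookup xs r ≡ y × drop (suc (toℕ r)) xs ≡ ys
suffix-lookup here = fzero , refl , refl
suffix-lookup (there s) with r , e₁ , e₂ ← suffix-lookup s = fsuc r , e₁ , e₂

belowHead : ∀ {y ys} → Linked _>_ (y ∷ ys) → All (_< y) ys
belowHead [-]       = []
belowHead (y>z ∷ l) = Linked⇒All (λ p q → <-trans q p) y>z l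

-- Hook of the box in column c of a row of length x, where `below` lists the
-- lengths of the rows beneath it; this is exactly the expression Defs.hook.
rowHook : ℕ → List ℕ → ℕ → ℕ
rowHook x below c = (x ∸ c) + length (filter (c <?_) below)

-- h is the first-column hook of some row listed in Q.
FirstHook : List ℕ → ℕ → Set
FirstHook Q h = Σ ℕ λ x → Σ (List ℕ) λ xs → Suffix (x ∷ xs) Q × x + length xs ≡ h

firstHook-mono : ∀ {Q P h} → Suffix Q P → FirstHook Q h → FirstHook P h
firstHook-mono t (x , xs , s , eq) = x , xs , suffix-trans s t , eq

rowHook-arm : ∀ {x c} xs → All (_≤ c) xs → rowHook x xs c ≡ x ∸ c
rowHook-arm {x} {c} xs le = begin
  (x ∸ c) + length (filter (c <?_) xs)
    ≡⟨ cong (λ ys → (x ∸ c) + length ys) (filter-none (c <?_) (All.map ≤⇒≯ le)) ⟩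
  (x ∸ c) + 0   ≡⟨ +-identityʳ _ ⟩
  x ∸ c         ∎
  where open ≡-Reasoning

rowHook-step : ∀ y g ys {c} → c < y → rowHook (y + g) (y ∷ ys) c ≡ suc (g + rowHook y ys c)
rowHook-step y g ys {c} c<y = begin
  ((y + g) ∸ c) + length (filter (c <?_) (y ∷ ys))
    ≡⟨ cong (λ zs → ((y + g) ∸ c) + length zs) (filter-accept (c <?_) c<y) ⟩
  ((y + g) ∸ c) + suc L   ≡⟨ cong (_+ suc L) (+-∸-comm g (<⇒≤ c<y)) ⟩
  ((y ∸ c) + g) + suc L   ≡⟨ regroup (y ∸ c) g L ⟩
  suc (g + ((y ∸ c) + L)) ∎
  where
  open ≡-Reasoning
  L : ℕ
  L = length (filter (c <?_) ys)
  regroup : ∀ a g L → (a + g) + suc L ≡ suc (g + (a + L))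
  regroup = solve-∀

rowHook-firstColumn : ∀ {x} xs → All (0 <_) xs → rowHook x xs 0 ≡ x + length xs
rowHook-firstColumn {x} xs pos = cong (λ ys → x + length ys) (filter-all (0 <?_) pos)

armBox : ∀ {x v} xs → All (_≤ x ∸ v) xs → 1 ≤ v → v ≤ x →
  Σ ℕ λ c → c < x × rowHook x xs c ≡ v
armBox {x} {v} xs le 1≤v v≤x =
  x ∸ v , ∸-monoʳ-< 1≤v v≤x , trans (rowHook-arm xs le) (m∸[m∸n]≡n v≤x)

-- Arithmetic for the recursive case of rowHooks, where row x = y + g lies
-- directly above row y and v = 1 + g + k.
gap-cancel : ∀ y g n k → suc (g + k) ≤ (y + g) + suc n → k ≤ y + n
gap-cancel y g n k le = +-cancelˡ-≤ g k (y + n) (≤-pred (subst (suc (g + k) ≤_) (regroup y g n) le))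
  where
  regroup : ∀ y g n → (y + g) + suc n ≡ suc (g + (y + n))
  regroup = solve-∀

gap-shift : ∀ h k y g n → h + k ≡ y + n → h + suc (g + k) ≡ (y + g) + suc n
gap-shift h k y g n h+k = begin
  h + suc (g + k)      ≡⟨ regroupˡ h k g ⟩
  suc (g + (h + k))    ≡⟨ cong (λ t → suc (g + t)) h+k ⟩
  suc (g + (y + n))    ≡⟨ regroupʳ y g n ⟩
  (y + g) + suc n      ∎
  where
  open ≡-Reasoning
  regroupˡ : ∀ h k g → h + suc (g + k) ≡ suc (g + (h + k))
  regroupˡ = solve-∀
  regroupʳ : ∀ y g n → suc (g + (y + n)) ≡ (y + g) + suc n
  regroupʳ = solve-∀

-- By induction on the rows: if
-- the next row is y = x - g, the columns right of it carry the hooks 1 … g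
-- (armBox), v = g + 1 is realised by row y itself, and every column left of
-- it shifts a hook of row y up by g + 1 (rowHook-step).
rowHooks : ∀ x xs → Linked _>_ (x ∷ xs) → ∀ v → v ≤ x + length xs →
  (Σ ℕ λ c → c < x × rowHook x xs c ≡ v)
  ⊎ (Σ ℕ λ h → FirstHook (x ∷ xs) h × h + v ≡ x + length xs)
rowHooks x xs _ zero _ = inj₂ (x + length xs , (x , xs , here , refl) , +-identityʳ _)
rowHooks x [] _ (suc v) le = inj₁ (armBox [] [] (s≤s z≤n) (subst (suc v ≤_) (+-identityʳ x) le))
rowHooks x (y ∷ ys) l (suc v) le with m≤n⇒∃[o]m+o≡n (<⇒≤ (linked-head l))
... | g , refl with suc v ≤? g
... | yes v<g = inj₁ (armBox (y ∷ ys) (y≤c ∷ All.map (λ z<y → ≤-trans (<⇒≤ z<y) y≤c) (belowHead (linked-tail l)))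
                              (s≤s z≤n) (≤-trans v<g (m≤n+m g y)))
  where
  y≤c : y ≤ (y + g) ∸ suc v
  y≤c = subst (y ≤_) (sym (+-∸-assoc y v<g)) (m≤m+n y (g ∸ suc v))
... | no v≮g with k , refl ← m≤n⇒∃[o]m+o≡n (≤-pred (≰⇒> v≮g))
  with rowHooks y ys (linked-tail l) k (gap-cancel y g (length ys) k le)
... | inj₁ (c , c<y , hk) =
  inj₁ (c , <-≤-trans c<y (m≤m+n y g) , trans (rowHook-step y g ys c<y) (cong (λ t → suc (g + t)) hk))
... | inj₂ (h , h∈ , h+k) =
  inj₂ (h , firstHook-mono (there here) h∈ , gap-shift h k y g (length ys) h+k)

firstHook-gap : ∀ {z zs y ys} → Linked _>_ (z ∷ zs) → Suffix (y ∷ ys) zs →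
  suc (suc (y + length ys)) ≤ z + length zs
firstHook-gap {z} {y = y} {ys} (z>y ∷ _) here =
  subst (suc (suc (y + length ys)) ≤_) (sym (+-suc z (length ys))) (s≤s (+-monoˡ-≤ (length ys) z>y))
firstHook-gap {z} {w ∷ ws} (z>w ∷ l) (there s) =
  ≤-trans (firstHook-gap l s) (+-mono-≤ (<⇒≤ z>w) (n≤1+n (length ws)))

firstHook-sparse : ∀ {Q h} → Linked _>_ Q → FirstHook Q h → FirstHook Q (suc h) → ⊥
firstHook-sparse l (x , xs , s , refl) (y , ys , t , e) = apart l s t e
  where
  apart : ∀ {Q x xs y ys} → Linked _>_ Q → Suffix (x ∷ xs) Q → Suffix (y ∷ ys) Q →
    y + length ys ≡ suc (x + length xs) → ⊥
  apart _ here      here      e = <-irrefl e (n<1+n _)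
  apart l here      (there t) e = ≤⇒≯ (m+n≤o⇒n≤o 2 (firstHook-gap l t)) (≤-reflexive (sym e))
  apart {x = x} {xs} l (there s) here e =
    1+n≰n (subst (suc (suc (x + length xs)) ≤_) e (firstHook-gap l s))
  apart l (there s) (there t) e = apart (linked-tail l) s t e

firstHook-positive : ∀ {Q h} → All (0 <_) Q → FirstHook Q h → 0 < h
firstHook-positive pos (x , xs , s , refl) with suffix-all s pos
... | 0<x ∷ _ = ≤-trans 0<x (m≤m+n x (length xs))

firstColumn∈H : (λ′ : Partition) (r : Fin (rows λ′)) → FirstHook (parts λ′) (hook λ′ r 0)
firstColumn∈H λ′ r =
  part λ′ r , below , lookup-suffix (parts λ′) r ,
  sym (rowHook-firstColumn below (drop⁺ (suc (toℕ r)) (positive λ′)))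
  where
  below : List ℕ
  below = drop (suc (toℕ r)) (parts λ′)

Descends : (ℕ → Set) → ℕ → Set
Descends H a = ∀ {h} → H (a + h) → H h

descends-multiple : ∀ {H} s → Descends H s → ∀ ℓ → Descends H (ℓ * s)
descends-multiple s d zero ih = ih
descends-multiple {H} s d (suc ℓ) {h} ih =
  descends-multiple {H} s d ℓ (d (subst H (+-assoc s (ℓ * s) h) ih))

-- A missing hook length a makes H closed under subtracting a: by rowHooks,
-- the row whose first-column hook is a + h would otherwise contain a hook a.
noHook⇒descends : (λ′ : Partition) → DistinctParts λ′ → ∀ {a} → ¬ HasHook λ′ a →
  Descends (FirstHook (parts λ′)) a
noHook⇒descends λ′ distinct {a} noHook {h} (x , xs , s , eq)
  with rowHooks x xs (suffix-linked s distinct) a (subst (a ≤_) (sym eq) (m≤m+n a h))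
... | inj₁ (c , c<x , hookEq) with suffix-lookup s
...   | r , refl , refl = ⊥-elim (noHook (r , c , c<x , hookEq))
noHook⇒descends λ′ distinct {a} noHook {h} (x , xs , s , eq)
    | inj₂ (h′ , h′∈ , h′+a) = subst (FirstHook (parts λ′)) h′≡h (firstHook-mono s h′∈)
  where
  h′≡h : h′ ≡ h
  h′≡h = +-cancelʳ-≡ a h′ h (trans h′+a (trans eq (+-comm a h)))

digits : ∀ s m {h} .{{_ : NonZero s}} → h < m * s → (∀ ℓ → h ≢ ℓ * s) →
  Σ ℕ λ ℓ → Σ ℕ λ i → ℓ + 1 ≤ m × 1 ≤ i × i + 1 ≤ s × h ≡ i + ℓ * s
digits s m {h} h<ms notMultiple = fromDivision (h % s) (h / s) (m≡m%n+[m/n]*n h s) (m%n<n h s)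
  where
  fromDivision : ∀ i ℓ → h ≡ i + ℓ * s → i < s →
    Σ ℕ λ ℓ → Σ ℕ λ i → ℓ + 1 ≤ m × 1 ≤ i × i + 1 ≤ s × h ≡ i + ℓ * s
  fromDivision zero    ℓ eq _   = ⊥-elim (notMultiple ℓ eq)
  fromDivision (suc i) ℓ eq i<s =
    ℓ , suc i , subst (_≤ m) (+-comm 1 ℓ) ℓ<m , s≤s z≤n , subst (_≤ s) (+-comm 1 (suc i)) i<s , eq
    where
    ℓ<m : ℓ < m
    ℓ<m = *-cancelʳ-< s ℓ m (≤-<-trans (subst (ℓ * s ≤_) (sym eq) (m≤n+m (ℓ * s) (suc i))) h<ms)

topDigit : ∀ s ℓ i → i + ℓ * s + 2 ≤ suc ℓ * s → i + 2 ≤ s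
topDigit s ℓ i le = +-cancelʳ-≤ (ℓ * s) (i + 2) s (subst (_≤ s + ℓ * s) (regroup i (ℓ * s)) le)
  where
  regroup : ∀ i n → i + n + 2 ≡ i + 2 + n
  regroup = solve-∀

lastBlock : ∀ {ℓ m} → ℓ + 1 ≤ m → ¬ ℓ + 2 ≤ m → m ≡ suc ℓ
lastBlock {ℓ} {m} ℓ+1≤m ℓ+2≰m =
  ≤-antisym (≤-pred (subst (suc m ≤_) (+-comm ℓ 2) (≰⇒> ℓ+2≰m))) (subst (_≤ m) (+-comm ℓ 1) ℓ+1≤m)

module SparseSet (H : ℕ → Set) (positive : ∀ {h} → H h → 0 < h)
                 (sparse : ∀ {h} → H h → H (suc h) → ⊥) where

  zero∉H : ¬ H 0
  zero∉H h0 = <-irrefl refl (positive h0)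

  descends-excludes : ∀ {a} → Descends H a → ¬ H a
  descends-excludes {a} d ha = zero∉H (d (subst H (sym (+-identityʳ a)) ha))

  -- Closed under subtracting a and a + 1, H contains nothing from a on:
  -- a + 0 would give 0 ∈ H, and a + (k + 1) would give both k + 1 and k.
  descends-above : ∀ {a} → Descends H a → Descends H (suc a) → ∀ k → ¬ H (a + k)
  descends-above da _   zero    hk = zero∉H (da hk)
  descends-above {a} da da₁ (suc k) hk = sparse (da₁ (subst H (+-suc a k) hk)) (da hk)

  descends-bound : ∀ {a h} → Descends H a → Descends H (suc a) → H h → h < a
  descends-bound {a} {h} da da₁ hh = ≰⇒> a≰h
    where
    a≰h : ¬ a ≤ h
    a≰h a≤h with k , eq ← m≤n⇒∃[o]m+o≡n a≤h = descends-above da da₁ k (subst H (sym eq) hh)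

  notMultiple : ∀ s {h} → Descends H s → H h → ∀ ℓ → h ≢ ℓ * s
  notMultiple s ds hh ℓ refl = descends-excludes (descends-multiple {H} s ds ℓ) hh

  core-s-s+1 : ∀ s {h} → Descends H s → Descends H (s + 1) → H h → 1 ≤ h × h + 1 ≤ s
  core-s-s+1 s {h} ds ds₁ hh =
    positive hh , subst (_≤ s) (+-comm 1 h) (descends-bound ds (subst (Descends H) (+-comm s 1) ds₁) hh)

  core-s-ms+1 : ∀ s m {h} .{{_ : NonZero s}} → Descends H s → Descends H (m * s + 1) → H h →
    Σ ℕ λ ℓ → Σ ℕ λ i → ℓ + 1 ≤ m × 1 ≤ i × i + 1 ≤ s × h ≡ i + ℓ * s
  core-s-ms+1 s m {h} ds dms₁ hh = digits s m h<ms (notMultiple s ds hh)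
    where
    h<ms : h < m * s
    h<ms = descends-bound (descends-multiple {H} s ds m) (subst (Descends H) (+-comm (m * s) 1) dms₁) hh

  bound-ms-1 : ∀ s m {h} → 2 ≤ m * s → Descends H s → Descends H (m * s ∸ 1) → H h → h + 2 ≤ m * s
  bound-ms-1 s m {h} 2≤ms ds dms₋₁ hh =
    subst (_≤ m * s) (sym (+-suc h 1)) (m≤o∸n⇒m+n≤o (suc h) 1≤ms h<ms-1)
    where
    1≤ms : 1 ≤ m * s
    1≤ms = ≤-trans (s≤s z≤n) 2≤ms
    dms : Descends H (suc (m * s ∸ 1))
    dms = subst (Descends H) (sym (m+[n∸m]≡n 1≤ms)) (descends-multiple {H} s ds m)
    h<ms-1 : h < m * s ∸ 1
    h<ms-1 = descends-bound dms₋₁ dms hh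

  core-s-ms-1 : ∀ s m {h} .{{_ : NonZero s}} → 2 ≤ m * s →
    Descends H s → Descends H (m * s ∸ 1) → H h →
    (Σ ℕ λ ℓ → Σ ℕ λ i → ℓ + 2 ≤ m × 1 ≤ i × i + 1 ≤ s × h ≡ i + ℓ * s)
    ⊎ (Σ ℕ λ i → 1 ≤ i × i + 2 ≤ s × h ≡ i + (m ∸ 1) * s)
  core-s-ms-1 s m {h} 2≤ms ds dms₋₁ hh
    with h+2≤ms ← bound-ms-1 s m 2≤ms ds dms₋₁ hh
    with digits s m (<-≤-trans (m<m+n h (s≤s z≤n)) h+2≤ms) (notMultiple s ds hh)
  ... | ℓ , i , ℓ+1≤m , 1≤i , i+1≤s , h≡ with ℓ + 2 ≤? m
  ...   | yes ℓ+2≤m = inj₁ (ℓ , i , ℓ+2≤m , 1≤i , i+1≤s , h≡)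
  ...   | no  ℓ+2≰m =
    inj₂ (i , 1≤i , topDigit s ℓ i (subst (λ t → t + 2 ≤ suc ℓ * s) h≡ h+2≤ℓs+s) ,
          subst (λ t → h ≡ i + (t ∸ 1) * s) (sym m≡ℓ+1) h≡)
    where
    m≡ℓ+1 : m ≡ suc ℓ
    m≡ℓ+1 = lastBlock ℓ+1≤m ℓ+2≰m
    h+2≤ℓs+s : h + 2 ≤ suc ℓ * s
    h+2≤ℓs+s = subst (λ t → h + 2 ≤ t * s) m≡ℓ+1 h+2≤ms

lemma4p2 : (s m : ℕ) → 1 ≤ s → 1 ≤ m → (λ′ : Partition) → DistinctParts λ′ →
    (IsCore s (s + 1) λ′ →
      FirstColumnHooksIn λ′ (λ h → 1 ≤ h × h + 1 ≤ s))
    × (2 ≤ m * s → IsCore s (m * s ∸ 1) λ′ →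
      FirstColumnHooksIn λ′ (λ h →
        (Σ ℕ λ ℓ → Σ ℕ λ i → ℓ + 2 ≤ m × 1 ≤ i × i + 1 ≤ s × h ≡ i + ℓ * s)
        ⊎ (Σ ℕ λ i → 1 ≤ i × i + 2 ≤ s × h ≡ i + (m ∸ 1) * s)))
    × (IsCore s (m * s + 1) λ′ →
      FirstColumnHooksIn λ′ (λ h →
        Σ ℕ λ ℓ → Σ ℕ λ i → ℓ + 1 ≤ m × 1 ≤ i × i + 1 ≤ s × h ≡ i + ℓ * s))
lemma4p2 s@(suc _) m _ _ λ′ distinct =
  (λ (noS , noS+1) r → core-s-s+1 s (descends noS) (descends noS+1) (firstColumn∈H λ′ r)) ,
  (λ 2≤ms (noS , noMS-1) r → core-s-ms-1 s m 2≤ms (descends noS) (descends noMS-1) (firstColumn∈H λ′ r)) ,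
  (λ (noS , noMS+1) r → core-s-ms+1 s m (descends noS) (descends noMS+1) (firstColumn∈H λ′ r))
  where
  H : ℕ → Set
  H = FirstHook (parts λ′)
  open SparseSet H (firstHook-positive (positive λ′)) (firstHook-sparse distinct)
  descends : ∀ {a} → ¬ HasHook λ′ a → Descends H a
  descends = noHook⇒descends λ′ distinct
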